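{- Let $(\mathcal A,<_A)$ and $(\mathcal B,<_B)$ be two ordered graphs and $k\in\mathbb N$. Then $(\mathcal A,<_A)$ and $(\mathcal B,<_B)$ satisfy exactly the same $\mathsf{CFO}$ sentences of quantifier rank at most $k$ if and only if Duplicator has a winning strategy in the $k$-round cluster Ehrenfeucht–Fraïssé game between $(\mathcal A,<_A)$ and $(\mathcal B,<_B)$.
   Context: Ordered graphs are structures over $\sigma\cup\{<\}$, $\sigma=\{E,P_1,\dots,P_N\}$, $E$ symmetric loopless binary, $P_\ell$ unary, $<$ a linear order. $\mathsf{CFO}$: fix an infinite alphabet $\Sigma$; variables $x_w^i$ ($w\in\Sigma^*$, $i\in\mathbb N$). For finite $S\subseteq\Sigma^*\times\mathbb N$, $X_S=\{x_w^i:(w,i)\in S\}$; $S$ is valid if $(w,i)\in S\Rightarrow(w,j)\in S$ for $j<i$ and $(w\alpha,0)\in S\Rightarrow(w,0)\in S$. $\mathsf{CFO}_S[0]$: Boolean combinations of $P_\ell(x_w^i)$, $E(x_w^i,x_w^j)$, $x_w^i\sim x_w^j$, $x_{w\alpha}^0\sim x_w^i$ (variables in $X_S$, $\sim\in\{=,<,>\}$). $\mathsf{CFO}_S[k+1]$: Boolean combinations of $\mathsf{CFO}_S[0]$ formulas and of $\exists x_\epsilon^0\psi$ ($S=\emptyset$, $\psi\in\mathsf{CFO}_{\{(\epsilon,0)\}}[k]$), $\exists x^0_{w\alpha}\psi$ ($(w,0)\in S$, $(w\alpha,0)\notin S$, $\psi\in\mathsf{CFO}_{S\cup\{(w\alpha,0)\}}[k]$),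 $\exists x_w^i(E(x_w^i,x_w^j)\wedge\psi)$ ($(w,j)\in S$, $i$ least with $(w,i)\notin S$, $\psi\in\mathsf{CFO}_{S\cup\{(w,i)\}}[k]$). The $\mathsf{CFO}$ sentences of quantifier rank $\le k$ are $\mathsf{CFO}_\emptyset[k]$. Cluster EF game: a configuration consists of a valid $S$ and pebble positions $p_w^i\in A$, $q_w^i\in B$ for $(w,i)\in S$. Starting from $S=\emptyset$, in each round Spoiler chooses one of the two structures (say $\mathcal A$; the other case is symmetric) and either (i) if $S=\emptyset$, places $p_\epsilon^0$ anywhere in $A$; (ii) if $S\ne\emptyset$, picks $w,\alpha$ with $(w,0)\in S$, $(w\alpha,0)\notin S$ and places $p_{w\alpha}^0$ anywhere in $A$; or (iii) picks $w$ with $(w,0)\in S$, lets $i$ be least with $(w,i)\notin S$, and places $p_w^i$ on an element adjacent to some $p_w^j$ with $j<i$. Duplicator answers by placing the corresponding pebble $q$ in the other structure; in case (iii) $q_w^i$ must be adjacent to $q_w^j$ (if impossible, Duplicator loses). The new pair is added to $S$. A configuration is winning for Duplicator if: for every $w$ with $(w,0)\in S$, the map $p_w^i\mapsto q_w^i$ ($(w,i)\in S$) is a partial isomorphism with respect to $E$, all $P_\ell$, $=$ and $<$; and for every $w,\alpha$ with $(w\alpha,0)\in S$, the map sending $p_w^i\mapsto q_w^i$ ($(w,i)\in S$) and $p_{w\alpha}^0\mapsto q_{w\alpha}^0$ is a partial isomorphism for the vocabulary $\{<\}$ (with equality). Duplicator wins the $k$-round game if she can ensure the configuration after $k$ rounds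 is winning, whatever Spoiler does. -}

module Defs where

open import Data.Nat using (ℕ; zero; suc; _<_)
open import Data.Fin using (Fin)
import Data.Fin as Fin
open import Data.Bool using (Bool; true; false; not; _∧_)
open import Data.List using (List; []; _∷_; _++_; [_]; allFin)
open import Data.Bool.ListAction using (any)
open import Data.List.Membership.Propositional using (_∈_; _∉_)
import Data.List.Properties as LP
import Data.Product.Properties as PP
open import Data.Product using (Σ; Σ-syntax; ∃; _×_; _,_)
open import Data.Sum using (_⊎_)
open import Data.Maybe using (Maybe; just; nothing)
open import Data.Unit using (⊤)
open import Data.Empty using (⊥)
open import Relation.Nullary using (¬_; yes; no)
open import Relation.Nullary.Decidable using (⌊_⌋)
open import Relation.Binary.PropositionalEquality using (_≡_; _≢_)
open import Function.Bundles using (_⇔_)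

-- Ordered graphs over σ ∪ {<}, σ = {E, P_1, …, P_N}  (finite structures;
-- the universe is Fin n, the linear order < is an arbitrary strict
-- linear order on it, given as a Boolean relation).

record OrderedGraph (N : ℕ) : Set where
  field
    size    : ℕ
    E       : Fin size → Fin size → Bool
    E-sym   : ∀ x y → E x y ≡ E y x
    E-irr   : ∀ x → E x x ≡ false
    P       : Fin N → Fin size → Bool
    lt      : Fin size → Fin size → Bool
    lt-irr  : ∀ x → lt x x ≡ false
    lt-trans : ∀ x y z → lt x y ≡ true → lt y z ≡ true → lt x z ≡ true
    lt-total : ∀ x y → x ≢ y → (lt x y ≡ true) ⊎ (lt y x ≡ true)

open OrderedGraph public

-- Variables x_w^i : the infinite alphabet Σ is ℕ, words are lists.

Word : Set
Word = List ℕ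

Var : Set
Var = Word × ℕ

_≟V_ : (u v : Var) → Relation.Nullary.Dec (u ≡ v)
_≟V_ = PP.≡-dec (LP.≡-dec Data.Nat._≟_) Data.Nat._≟_
  where import Data.Nat

data Cmp : Set where
  ceq clt cgt : Cmp

data Formula (N : ℕ) : Set where
  fP   : Fin N → Var → Formula N
  fE   : Var → Var → Formula N
  fCmp : Cmp → Var → Var → Formula N
  fTrue : Formula N
  fNot : Formula N → Formula N
  fAnd : Formula N → Formula N → Formula N
  fEx  : Var → Formula N → Formula N

data Atom {N : ℕ} (S : List Var) : Formula N → Set where
  aP   : ∀ ℓ v → v ∈ S → Atom S (fP ℓ v)
  aE   : ∀ w i j → (w , i) ∈ S → (w , j) ∈ S → Atom S (fE (w , i) (w , j))
  aCmp : ∀ r w i j → (w , i) ∈ S → (w , j) ∈ S → Atom S (fCmp r (w , i) (w , j))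
  aChild : ∀ r w α i → (w ++ [ α ] , 0) ∈ S → (w , i) ∈ S →
           Atom S (fCmp r (w ++ [ α ] , 0) (w , i))

data CFO {N : ℕ} (S : List Var) : ℕ → Formula N → Set where
  atom : ∀ {k φ} → Atom S φ → CFO S k φ
  true : ∀ {k} → CFO S k fTrue
  neg  : ∀ {k φ} → CFO S k φ → CFO S k (fNot φ)
  conj : ∀ {k φ ψ} → CFO S k φ → CFO S k ψ → CFO S k (fAnd φ ψ)
  exRoot : ∀ {k ψ} → S ≡ [] → CFO (([] , 0) ∷ []) k ψ →
           CFO S (suc k) (fEx ([] , 0) ψ)
  exChild : ∀ {k ψ} w α → (w , 0) ∈ S → (w ++ [ α ] , 0) ∉ S →
            CFO ((w ++ [ α ] , 0) ∷ S) k ψ →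
            CFO S (suc k) (fEx (w ++ [ α ] , 0) ψ)
  exNbr : ∀ {k ψ} w i j → (w , j) ∈ S → (w , i) ∉ S →
          (∀ i′ → i′ < i → (w , i′) ∈ S) →
          CFO ((w , i) ∷ S) k ψ →
          CFO S (suc k) (fEx (w , i) (fAnd (fE (w , i) (w , j)) ψ))

-- Semantics (partial assignments; unassigned variables make atoms false)

Env : ∀ {N} → OrderedGraph N → Set
Env G = Var → Maybe (Fin (size G))

emptyEnv : ∀ {N} (G : OrderedGraph N) → Env G
emptyEnv G _ = nothing

update : ∀ {N} (G : OrderedGraph N) → Env G → Var → Fin (size G) → Env G
update G ρ x a y with y ≟V x
... | yes _ = just a
... | no _  = ρ y

lift2 : ∀ {A : Set} → (A → A → Bool) → Maybe A → Maybe A → Bool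
lift2 f (just a) (just b) = f a b
lift2 f _ _ = false

lift1 : ∀ {A : Set} → (A → Bool) → Maybe A → Bool
lift1 f (just a) = f a
lift1 f nothing = false

eqF : ∀ {n} → Fin n → Fin n → Bool
eqF a b = ⌊ a Fin.≟ b ⌋

cmpSem : ∀ {N} (G : OrderedGraph N) → Cmp → Fin (size G) → Fin (size G) → Bool
cmpSem G ceq a b = eqF a b
cmpSem G clt a b = lt G a b
cmpSem G cgt a b = lt G b a

sat : ∀ {N} (G : OrderedGraph N) → Env G → Formula N → Bool
sat G ρ (fP ℓ x) = lift1 (P G ℓ) (ρ x)
sat G ρ (fE x y) = lift2 (E G) (ρ x) (ρ y)
sat G ρ (fCmp r x y) = lift2 (cmpSem G r) (ρ x) (ρ y)
sat G ρ fTrue = true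
sat G ρ (fNot φ) = not (sat G ρ φ)
sat G ρ (fAnd φ ψ) = sat G ρ φ ∧ sat G ρ ψ
sat G ρ (fEx x φ) = any (λ a → sat G (update G ρ x a) φ) (allFin (size G))

SameCFO : ∀ {N} → ℕ → OrderedGraph N → OrderedGraph N → Set
SameCFO {N} k A B = ∀ (φ : Formula N) → CFO [] k φ →
  sat A (emptyEnv A) φ ≡ sat B (emptyEnv B) φ

-- Spoiler's legal choice of the next pebble v, together with the
-- optional pebble (w , j) it has to be adjacent to (move (iii)).
data Move (S : List Var) : Var → Maybe Var → Set where
  mRoot  : S ≡ [] → Move S ([] , 0) nothing
  mChild : ∀ w α → (w , 0) ∈ S → (w ++ [ α ] , 0) ∉ S →
           Move S (w ++ [ α ] , 0) nothing
  mNbr   : ∀ w i j → (w , 0) ∈ S → (w , i) ∉ S →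
           (∀ i′ → i′ < i → (w , i′) ∈ S) → j < i →
           Move S (w , i) (just (w , j))

Anchored : ∀ {N} (G : OrderedGraph N) → Env G → Maybe Var → Fin (size G) → Set
Anchored G ρ nothing a = ⊤
Anchored G ρ (just u) a = lift2 (E G) (just a) (ρ u) ≡ true

OrdAgree : ∀ {N} (A B : OrderedGraph N) → Env A → Env B → Var → Var → Set
OrdAgree A B p q u v =
  (lift2 eqF (p u) (p v) ≡ lift2 eqF (q u) (q v)) ×
  (lift2 (lt A) (p u) (p v) ≡ lift2 (lt B) (q u) (q v))

FullAgree : ∀ {N} (A B : OrderedGraph N) → Env A → Env B → Var → Var → Set
FullAgree A B p q u v =
  OrdAgree A B p q u v × (lift2 (E A) (p u) (p v) ≡ lift2 (E B) (q u) (q v))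

Winning : ∀ {N} (A B : OrderedGraph N) → List Var → Env A → Env B → Set
Winning {N} A B S p q =
  (∀ w → (w , 0) ∈ S →
     (∀ i → (w , i) ∈ S → (∀ ℓ → lift1 (P A ℓ) (p (w , i)) ≡ lift1 (P B ℓ) (q (w , i))))
   × (∀ i j → (w , i) ∈ S → (w , j) ∈ S → FullAgree A B p q (w , i) (w , j)))
  × (∀ w α → (w ++ [ α ] , 0) ∈ S →
       ∀ u v → InCl w α u → InCl w α v → OrdAgree A B p q u v)
  where
    InCl : Word → ℕ → Var → Set
    InCl w α u = (Σ[ i ∈ ℕ ] (u ≡ (w , i) × u ∈ S)) ⊎ (u ≡ (w ++ [ α ] , 0))

DupWinsFrom : ∀ {N} (A B : OrderedGraph N) → ℕ → List Var → Env A → Env B → Set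
DupWinsFrom A B zero S p q = Winning A B S p q
DupWinsFrom A B (suc k) S p q =
  (∀ v m → Move S v m → (a : Fin (size A)) → Anchored A p m a →
     Σ[ b ∈ Fin (size B) ] (Anchored B q m b ×
       DupWinsFrom A B k (v ∷ S) (update A p v a) (update B q v b)))
  ×
  (∀ v m → Move S v m → (b : Fin (size B)) → Anchored B q m b →
     Σ[ a ∈ Fin (size A) ] (Anchored A p m a ×
       DupWinsFrom A B k (v ∷ S) (update A p v a) (update B q v b)))

DupWins : ∀ {N} → ℕ → OrderedGraph N → OrderedGraph N → Set
DupWins k A B = DupWinsFrom A B k [] (emptyEnv A) (emptyEnv B)

module Submission where

-- Duplicator ⇒ equivalence, by induction on a formula of CFO_S[k]: its quantifiers ∃v ψ and
-- ∃v (E(v, u) ∧ ψ) are exactly the legal Spoiler moves placing v (next to u), which Duplicator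
-- answers, and its atoms are exactly what a winning configuration preserves; a k-round strategy
-- reaches a winning configuration by answering dummy moves.
--
-- Equivalence ⇒ Duplicator: the k-round type of a configuration (S, p) of A is described by a
-- Hintikka formula H_k of CFO_S[k]: for k = 0 the conjunction of the atoms of S true at p and the
-- negations of the false ones; for k + 1, for every move placing v, the back-and-forth formula
--   ⋀_a ∃v (guard ∧ H_k[v ↦ a])  ∧  ¬ ∃v (guard ∧ ¬ ⋁_a H_k[v ↦ a]).
-- Finitely many moves suffice: a neighbour move has a determined index, and child moves with
-- different letters are interchangeable since the game is invariant under renaming letters.
-- If B satisfies the Hintikka formula of A, Duplicator answers each move by an element
-- realising the same next Hintikka formula.

open import Defs
open import Data.Nat using (ℕ; zero; suc; _<_; _≤_; _⊔_; _≟_; z≤n; s≤s)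
open import Data.Nat.Properties
  using ( <-irrefl; <-cmp; ≤-trans; ≤-pred; m≤m+n; m≤n+m; m≤m⊔n; m≤n⊔m
        ; m≤n⇒m<n∨m≡n; ⊔-sel)
open import Data.Nat.ListAction using (sum)
open import Data.Nat.ListAction.Properties using (sum-++)
open import Data.Fin using (Fin)
import Data.Fin as Fin
open import Data.Bool using (Bool; true; false; not; _∧_; if_then_else_)
open import Data.Bool.Properties using (not-involutive; ⇔→≡; T-≡) renaming (_≟_ to _≟ᵇ_)
open import Data.Bool.ListAction using (any)
open import Data.List
  using (List; []; _∷_; _++_; [_]; _∷ʳ_; map; allFin; filter; concatMap; upTo; initLast; _∷ʳ′_)
import Data.List.Properties as List
open import Data.List.Membership.Propositional using (_∈_; _∉_; find; lose)
open import Data.List.Membership.Propositional.Properties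
  using ( ∈-map⁺; ∈-map⁻; ∈-allFin; ∈-filter⁺; ∈-filter⁻; ∈-++⁺ˡ; ∈-++⁺ʳ; ∈-++⁻
        ; ∈-concatMap⁺; ∈-concatMap⁻; ∈-upTo⁺; ∈-upTo⁻)
open import Data.List.Relation.Unary.Any using (here; there)
open import Data.List.Relation.Unary.Any.Properties using (any⁺; any⁻)
open import Data.Product using (Σ-syntax; ∃-syntax; _×_; _,_; proj₁; proj₂)
import Data.Product as Product
open import Data.Sum using (_⊎_; inj₁; inj₂)
open import Data.Maybe using (Maybe; just; nothing)
import Data.Maybe as Maybe
open import Data.Empty using (⊥-elim)
open import Data.Unit using (⊤; tt)
open import Function using (_∘_; id; flip)
open import Function.Bundles using (_⇔_; mk⇔; Equivalence)
open import Relation.Nullary using (¬_; Dec; yes; no)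
open import Relation.Binary.PropositionalEquality
  using (_≡_; _≢_; refl; sym; trans; cong; cong₂; subst)
open import Relation.Binary using (tri<; tri≈; tri>)

open Equivalence using (to; from)

_≟W_ : (u v : Word) → Dec (u ≡ v)
_≟W_ = List.≡-dec _≟_

any≡true⇔ : ∀ {X : Set} (f : X → Bool) xs → any f xs ≡ true ⇔ (∃[ x ] x ∈ xs × f x ≡ true)
any≡true⇔ f xs = mk⇔
  (λ e → let x , x∈xs , fx = find (any⁻ f xs (from T-≡ e)) in x , x∈xs , to T-≡ fx)
  (λ (x , x∈xs , fx) → to T-≡ (any⁺ f (lose x∈xs (from T-≡ fx))))

∈⇒≤sum : ∀ {n ns} → n ∈ ns → n ≤ sum ns
∈⇒≤sum {ns = n ∷ ns} (here refl) = m≤m+n n (sum ns)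
∈⇒≤sum {ns = m ∷ ns} (there n∈ns) = ≤-trans (∈⇒≤sum n∈ns) (m≤n+m (sum ns) m)

record Valid (S : List Var) : Set where
  field
    index-closed  : ∀ {w i j} → (w , i) ∈ S → j < i → (w , j) ∈ S
    prefix-closed : ∀ {w α} → (w ∷ʳ α , 0) ∈ S → (w , 0) ∈ S

open Valid

valid-[] : Valid []
valid-[] = record { index-closed = λ () ; prefix-closed = λ () }

cluster-∈ : ∀ {S w i} → Valid S → (w , i) ∈ S → (w , 0) ∈ S
cluster-∈ {i = zero}  V w∈S = w∈S
cluster-∈ {i = suc i} V w∈S = index-closed V w∈S (s≤s z≤n)

prefix-∈ : ∀ {S} → Valid S → ∀ u r → (u ++ r , 0) ∈ S → (u , 0) ∈ S
prefix-∈ {S} V u [] ur∈S = subst (λ x → (x , 0) ∈ S) (List.++-identityʳ u) ur∈S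
prefix-∈ {S} V u (α ∷ r) ur∈S =
  prefix-closed V (prefix-∈ V (u ∷ʳ α) r
    (subst (λ x → (x , 0) ∈ S) (sym (List.∷ʳ-++ u α r)) ur∈S))

∷ʳ≢[] : ∀ (w : Word) α → w ∷ʳ α ≢ []
∷ʳ≢[] []      α ()
∷ʳ≢[] (_ ∷ _) α ()

valid-move : ∀ {S v m} → Valid S → Move S v m → Valid (v ∷ S)
valid-move V (mRoot refl) = record
  { index-closed  = λ { (here refl) () }
  ; prefix-closed = λ { {w} {α} (here e) → ⊥-elim (∷ʳ≢[] w α (cong proj₁ e)) }
  }
valid-move V (mChild w α w∈S _) = record
  { index-closed  = λ { (here refl) () ; (there u∈S) j<i → there (index-closed V u∈S j<i) }
  ; prefix-closed = λ { {u} (here e) → there (subst (λ x → (x , 0) ∈ _)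
                                                    (sym (List.∷ʳ-injectiveˡ u w (cong proj₁ e))) w∈S)
                      ; (there u∈S) → there (prefix-closed V u∈S) }
  }
valid-move V (mNbr w i j w∈S wi∉S below _) = record
  { index-closed  = λ { (here refl) j<i → there (below _ j<i)
                      ; (there u∈S) j<i → there (index-closed V u∈S j<i) }
  ; prefix-closed = λ { (here refl) → ⊥-elim (wi∉S w∈S)
                      ; (there u∈S) → there (prefix-closed V u∈S) }
  }

letterSum : List Var → ℕ
letterSum S = sum (map (sum ∘ proj₁) S)

freshLetter : List Var → ℕ
freshLetter S = suc (letterSum S)

freshLetter-fresh : ∀ S w → (w ∷ʳ freshLetter S , 0) ∉ S
freshLetter-fresh S w child∈S =
  <-irrefl refl (≤-trans last≤sum (∈⇒≤sum (∈-map⁺ (sum ∘ proj₁) child∈S)))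
  where
  α = freshLetter S
  last≤sum : α ≤ sum (w ∷ʳ α)
  last≤sum = subst (α ≤_) (sym (sum-++ w [ α ])) (≤-trans (m≤m+n α 0) (m≤n+m _ (sum w)))

nextIndex : List Var → Word → ℕ
nextIndex []            w = 0
nextIndex ((u , i) ∷ S) w with u ≟W w
... | yes _ = suc i ⊔ nextIndex S w
... | no _  = nextIndex S w

<-nextIndex : ∀ {S w i} → (w , i) ∈ S → i < nextIndex S w
<-nextIndex {(u , i) ∷ S} {w} w∈S with u ≟W w
<-nextIndex {(u , i) ∷ S} (here refl) | yes _ = m≤m⊔n (suc i) (nextIndex S u)
<-nextIndex {(u , i) ∷ S} (there w∈S) | yes _ = ≤-trans (<-nextIndex w∈S) (m≤n⊔m (suc i) _)
<-nextIndex               (here refl) | no u≢w = ⊥-elim (u≢w refl)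
<-nextIndex               (there w∈S) | no _   = <-nextIndex w∈S

nextIndex-∉ : ∀ S w → (w , nextIndex S w) ∉ S
nextIndex-∉ S w w∈S = <-irrefl refl (<-nextIndex w∈S)

<nextIndex⇒≤index : ∀ S w {j} → j < nextIndex S w → ∃[ i ] j ≤ i × (w , i) ∈ S
<nextIndex⇒≤index ((u , i) ∷ S) w j< with u ≟W w
... | no _ = let i′ , j≤i′ , w∈S = <nextIndex⇒≤index S w j< in i′ , j≤i′ , there w∈S
... | yes refl with ⊔-sel (suc i) (nextIndex S w)
...   | inj₁ e = i , ≤-pred (subst (_ <_) e j<) , here refl
...   | inj₂ e =
  let i′ , j≤i′ , w∈S = <nextIndex⇒≤index S w (subst (_ <_) e j<) in i′ , j≤i′ , there w∈S

<nextIndex⇒∈ : ∀ {S} → Valid S → ∀ w {j} → j < nextIndex S w → (w , j) ∈ S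
<nextIndex⇒∈ {S} V w j< with <nextIndex⇒≤index S w j<
... | i , j≤i , w∈S with m≤n⇒m<n∨m≡n j≤i
...   | inj₁ j<i  = index-closed V w∈S j<i
...   | inj₂ refl = w∈S

nextIndex-unique : ∀ {S w i} → Valid S → (w , i) ∉ S → (∀ j → j < i → (w , j) ∈ S) →
                   i ≡ nextIndex S w
nextIndex-unique {S} {w} {i} V wi∉S below with <-cmp i (nextIndex S w)
... | tri< i<n _ _ = ⊥-elim (wi∉S (<nextIndex⇒∈ V w i<n))
... | tri≈ _ i≡n _ = i≡n
... | tri> _ _ n<i = ⊥-elim (nextIndex-∉ S w (below _ n<i))

move-∉ : ∀ {S v m} → Move S v m → v ∉ S
move-∉ (mRoot refl) ()
move-∉ (mChild _ _ _ child∉S) = child∉S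
move-∉ (mNbr _ _ _ _ wi∉S _ _) = wi∉S

∈∉⇒< : ∀ {S w i j} → Valid S → (w , j) ∈ S → (w , i) ∉ S → j < i
∈∉⇒< {i = i} {j} V wj∈S wi∉S with <-cmp j i
... | tri< j<i _ _ = j<i
... | tri≈ _ refl _ = ⊥-elim (wi∉S wj∈S)
... | tri> _ _ i<j = ⊥-elim (wi∉S (index-closed V wj∈S i<j))

anchor-∈ : ∀ {S v u} → Move S v (just u) → u ∈ S
anchor-∈ (mNbr w i j _ _ below j<i) = below j j<i

module _ {N} (G : OrderedGraph N) where

  update-≡ : ∀ (ρ : Env G) x a → update G ρ x a x ≡ just a
  update-≡ ρ x a with x ≟V x
  ... | yes _  = refl
  ... | no x≢x = ⊥-elim (x≢x refl)

  update-≢ : ∀ (ρ : Env G) x a {y} → y ≢ x → update G ρ x a y ≡ ρ y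
  update-≢ ρ x a {y} y≢x with y ≟V x
  ... | yes y≡x = ⊥-elim (y≢x y≡x)
  ... | no _    = refl

  Sat : Env G → Formula N → Set
  Sat ρ φ = sat G ρ φ ≡ true

  module _ (ρ : Env G) where

    sat-not : ∀ φ → Sat ρ (fNot φ) ⇔ (¬ Sat ρ φ)
    sat-not φ with sat G ρ φ
    ... | true  = mk⇔ (λ ()) (λ ¬t → ⊥-elim (¬t refl))
    ... | false = mk⇔ (λ _ ()) (λ _ → refl)

    sat-and : ∀ φ ψ → Sat ρ (fAnd φ ψ) ⇔ (Sat ρ φ × Sat ρ ψ)
    sat-and φ ψ with sat G ρ φ | sat G ρ ψ
    ... | true  | true  = mk⇔ (λ _ → refl , refl) (λ _ → refl)
    ... | true  | false = mk⇔ (λ ()) proj₂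
    ... | false | _     = mk⇔ (λ ()) proj₁

    sat-ex : ∀ v φ → Sat ρ (fEx v φ) ⇔ (∃[ a ] Sat (update G ρ v a) φ)
    sat-ex v φ = mk⇔
      (λ e → let a , _ , sa = to (any≡true⇔ _ (allFin (size G))) e in a , sa)
      (λ (a , sa) → from (any≡true⇔ _ (allFin (size G))) (a , ∈-allFin a , sa))

    sat? : ∀ φ → Dec (Sat ρ φ)
    sat? φ = sat G ρ φ ≟ᵇ true

bigAnd : ∀ {N} {X : Set} → (X → Formula N) → List X → Formula N
bigAnd f []       = fTrue
bigAnd f (x ∷ xs) = fAnd (f x) (bigAnd f xs)

bigOr : ∀ {N} {X : Set} → (X → Formula N) → List X → Formula N
bigOr f []       = fNot fTrue
bigOr f (x ∷ xs) = fNot (fAnd (fNot (f x)) (fNot (bigOr f xs)))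

module _ {N} (G : OrderedGraph N) (ρ : Env G) {X : Set} (f : X → Formula N) where

  sat-bigAnd : ∀ xs → Sat G ρ (bigAnd f xs) ⇔ (∀ {x} → x ∈ xs → Sat G ρ (f x))
  sat-bigAnd []       = mk⇔ (λ _ ()) (λ _ → refl)
  sat-bigAnd (x ∷ xs) = mk⇔
    (λ s → let fx , rest = to (sat-and G ρ (f x) (bigAnd f xs)) s in
           λ { (here refl) → fx ; (there x∈xs) → to (sat-bigAnd xs) rest x∈xs })
    (λ h → from (sat-and G ρ (f x) (bigAnd f xs))
             (h (here refl) , from (sat-bigAnd xs) (λ x∈xs → h (there x∈xs))))

  sat-bigOr≡any : ∀ xs → sat G ρ (bigOr f xs) ≡ any (sat G ρ ∘ f) xs
  sat-bigOr≡any []       = refl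
  sat-bigOr≡any (x ∷ xs) with sat G ρ (f x)
  ... | true  = refl
  ... | false = trans (not-involutive _) (sat-bigOr≡any xs)

  sat-bigOr : ∀ xs → Sat G ρ (bigOr f xs) ⇔ (∃[ x ] x ∈ xs × Sat G ρ (f x))
  sat-bigOr xs = mk⇔
    (λ s → to (any≡true⇔ _ xs) (trans (sym (sat-bigOr≡any xs)) s))
    (λ w → trans (sat-bigOr≡any xs) (from (any≡true⇔ _ xs) w))

module _ {N} {S : List Var} {k : ℕ} {X : Set} (f : X → Formula N) where

  bigAnd-cfo : ∀ xs → (∀ {x} → x ∈ xs → CFO S k (f x)) → CFO S k (bigAnd f xs)
  bigAnd-cfo []       _ = true
  bigAnd-cfo (x ∷ xs) c = conj (c (here refl)) (bigAnd-cfo xs (λ x∈xs → c (there x∈xs)))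

  bigOr-cfo : ∀ xs → (∀ {x} → x ∈ xs → CFO S k (f x)) → CFO S k (bigOr f xs)
  bigOr-cfo []       _ = neg true
  bigOr-cfo (x ∷ xs) c =
    neg (conj (neg (c (here refl))) (neg (bigOr-cfo xs (λ x∈xs → c (there x∈xs)))))

guarded : ∀ {N} → Maybe Var → Var → Formula N → Formula N
guarded nothing  v ψ = ψ
guarded (just u) v ψ = fAnd (fE v u) ψ

AnchorDistinct : Var → Maybe Var → Set
AnchorDistinct v nothing  = ⊤
AnchorDistinct v (just u) = u ≢ v

move-anchorDistinct : ∀ {S v m} → Move S v m → AnchorDistinct v m
move-anchorDistinct (mRoot _)              = tt
move-anchorDistinct (mChild _ _ _ _)       = tt
move-anchorDistinct (mNbr _ _ _ _ _ _ j<i) = λ e → <-irrefl (cong proj₂ e) j<i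

ex-cfo : ∀ {N S k v m} {ψ : Formula N} → Move S v m → CFO (v ∷ S) k ψ →
         CFO S (suc k) (fEx v (guarded m v ψ))
ex-cfo (mRoot refl)                   c = exRoot refl c
ex-cfo (mChild w α w∈S child∉S)       c = exChild w α w∈S child∉S c
ex-cfo (mNbr w i j _ wi∉S below j<i) c = exNbr w i j (below j j<i) wi∉S below c

module _ {N} (G : OrderedGraph N) where

  sat-guarded : ∀ ρ {v m} a ψ → AnchorDistinct v m →
                Sat G (update G ρ v a) (guarded m v ψ) ⇔ (Anchored G ρ m a × Sat G (update G ρ v a) ψ)
  sat-guarded ρ {m = nothing} a ψ _ = mk⇔ (tt ,_) proj₂
  sat-guarded ρ {v} {just u} a ψ u≢v = mk⇔
    (λ s → let e , sψ = to (sat-and G ρ′ (fE v u) ψ) s in trans (sym edge) e , sψ)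
    (λ (an , sψ) → from (sat-and G ρ′ (fE v u) ψ) (trans edge an , sψ))
    where
    ρ′ = update G ρ v a
    edge : sat G ρ′ (fE v u) ≡ lift2 (E G) (just a) (ρ u)
    edge = cong₂ (lift2 (E G)) (update-≡ G ρ v a) (update-≢ G ρ v a u≢v)

  anchored? : ∀ ρ m (a : Fin (size G)) → Dec (Anchored G ρ m a)
  anchored? ρ nothing  a = yes tt
  anchored? ρ (just u) a = lift2 (E G) (just a) (ρ u) ≟ᵇ true

  candidates : Env G → Maybe Var → List (Fin (size G))
  candidates ρ m = filter (anchored? ρ m) (allFin (size G))

  ∈-candidates : ∀ {ρ m a} → Anchored G ρ m a → a ∈ candidates ρ m
  ∈-candidates {ρ} {m} {a} an = ∈-filter⁺ (anchored? ρ m) (∈-allFin a) an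

  candidate-anchored : ∀ {ρ m a} → a ∈ candidates ρ m → Anchored G ρ m a
  candidate-anchored {ρ} {m} a∈ = proj₂ (∈-filter⁻ (anchored? ρ m) {xs = allFin (size G)} a∈)

module _ {N} (A : OrderedGraph N) (p : Env A) (v : Var) (m : Maybe Var)
         (Ψ : Fin (size A) → Formula N) where

  forthFormula backFormula moveFormula : Formula N
  forthFormula = bigAnd (λ a → fEx v (guarded m v (Ψ a))) (candidates A p m)
  backFormula  = fNot (fEx v (guarded m v (fNot (bigOr Ψ (candidates A p m)))))
  moveFormula  = fAnd forthFormula backFormula

  module _ (G : OrderedGraph N) (ρ : Env G) where

    Forth Back : Set
    Forth = ∀ a → Anchored A p m a → ∃[ b ] Anchored G ρ m b × Sat G (update G ρ v b) (Ψ a)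
    Back  = ∀ b → Anchored G ρ m b → ∃[ a ] Anchored A p m a × Sat G (update G ρ v b) (Ψ a)

    sat-forthFormula : AnchorDistinct v m → Sat G ρ forthFormula ⇔ Forth
    sat-forthFormula v≠m = mk⇔
      (λ s a an →
        let b , g   = to (sat-ex G ρ v (guarded m v (Ψ a))) (to (sat-bigAnd G ρ _ _) s (∈-candidates A an))
            bn , sb = to (sat-guarded G ρ b (Ψ a) v≠m) g
        in b , bn , sb)
      (λ forth → from (sat-bigAnd G ρ _ _) λ {a} a∈ →
        let b , bn , sb = forth a (candidate-anchored A a∈) in
        from (sat-ex G ρ v (guarded m v (Ψ a))) (b , from (sat-guarded G ρ b (Ψ a) v≠m) (bn , sb)))

    sat-backFormula : AnchorDistinct v m → Sat G ρ backFormula ⇔ Back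
    sat-backFormula v≠m = mk⇔ elim intro
      where
      some none : Formula N
      some = bigOr Ψ (candidates A p m)
      none = fNot some

      intro : Back → Sat G ρ backFormula
      intro back = from (sat-not G ρ (fEx v (guarded m v none))) λ s →
        let b , g       = to (sat-ex G ρ v (guarded m v none)) s
            bn , ¬some  = to (sat-guarded G ρ b none v≠m) g
            a , an , sa = back b bn
        in to (sat-not G _ some) ¬some (from (sat-bigOr G _ Ψ _) (a , ∈-candidates A an , sa))

      elim : Sat G ρ backFormula → Back
      elim s b bn with sat? G (update G ρ v b) some
      ... | yes ssome = let a , a∈ , sa = to (sat-bigOr G _ Ψ _) ssome in a , candidate-anchored A a∈ , sa
      ... | no ¬some  = ⊥-elim (to (sat-not G ρ (fEx v (guarded m v none))) s
                          (from (sat-ex G ρ v (guarded m v none))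
                             (b , from (sat-guarded G ρ b none v≠m) (bn , from (sat-not G _ some) ¬some))))

    sat-moveFormula : AnchorDistinct v m → Sat G ρ moveFormula ⇔ (Forth × Back)
    sat-moveFormula v≠m = mk⇔
      (Product.map (to (sat-forthFormula v≠m)) (to (sat-backFormula v≠m)) ∘ to split)
      (from split ∘ Product.map (from (sat-forthFormula v≠m)) (from (sat-backFormula v≠m)))
      where split = sat-and G ρ forthFormula backFormula

  moveFormula-cfo : ∀ {S k} → Move S v m → (∀ a → CFO (v ∷ S) k (Ψ a)) → CFO S (suc k) moveFormula
  moveFormula-cfo mv c =
    conj (bigAnd-cfo _ (candidates A p m) (λ _ → ex-cfo mv (c _)))
         (neg (ex-cfo mv (neg (bigOr-cfo Ψ (candidates A p m) (λ _ → c _)))))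

-- Invariance of the game under renaming letters

-- The two components of Winning (with InCluster its local InCl) and of DupWinsFrom (suc k).
InCluster : List Var → Word → ℕ → Var → Set
InCluster S w α u = (Σ[ i ∈ ℕ ] (u ≡ (w , i) × u ∈ S)) ⊎ (u ≡ (w ∷ʳ α , 0))

module _ {N} (A B : OrderedGraph N) where

  ClustersAgree : List Var → Env A → Env B → Set
  ClustersAgree S p q = ∀ w → (w , 0) ∈ S →
      (∀ i → (w , i) ∈ S → ∀ ℓ → lift1 (P A ℓ) (p (w , i)) ≡ lift1 (P B ℓ) (q (w , i)))
    × (∀ i j → (w , i) ∈ S → (w , j) ∈ S → FullAgree A B p q (w , i) (w , j))

  ChildrenAgree : List Var → Env A → Env B → Set
  ChildrenAgree S p q = ∀ w α → (w ∷ʳ α , 0) ∈ S →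
    ∀ u v → InCluster S w α u → InCluster S w α v → OrdAgree A B p q u v

  ForthAnswers BackAnswers : ℕ → List Var → Env A → Env B → Var → Maybe Var → Set
  ForthAnswers k S p q v m = ∀ a → Anchored A p m a →
    ∃[ b ] Anchored B q m b × DupWinsFrom A B k (v ∷ S) (update A p v a) (update B q v b)
  BackAnswers k S p q v m = ∀ b → Anchored B q m b →
    ∃[ a ] Anchored A p m a × DupWinsFrom A B k (v ∷ S) (update A p v a) (update B q v b)

record WordRenaming : Set where
  field
    rename            : Word → Word
    renameLast        : Word → ℕ → ℕ
    rename-involutive : ∀ u → rename (rename u) ≡ u
    rename-[]         : rename [] ≡ []
    rename-∷ʳ         : ∀ u α → rename (u ∷ʳ α) ≡ rename u ∷ʳ renameLast u α

  renameVar : Var → Var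
  renameVar (w , i) = rename w , i

  renameVar-involutive : ∀ u → renameVar (renameVar u) ≡ u
  renameVar-involutive (w , i) = cong (_, i) (rename-involutive w)

  renameVar-injective : ∀ {u v} → renameVar u ≡ renameVar v → u ≡ v
  renameVar-injective {u} {v} e =
    trans (sym (renameVar-involutive u)) (trans (cong renameVar e) (renameVar-involutive v))

identityRenaming : WordRenaming
identityRenaming = record
  { rename = λ w → w ; renameLast = λ _ α → α
  ; rename-involutive = λ _ → refl ; rename-[] = refl ; rename-∷ʳ = λ _ _ → refl }

module Renaming {N} (A B : OrderedGraph N) (R : WordRenaming) where
  open WordRenaming R

  Pulls : (G : OrderedGraph N) → List Var → Env G → Env G → Set
  Pulls G T ρ′ ρ = ∀ {u} → u ∈ T → ρ′ u ≡ ρ (renameVar u)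

  record Pullback (S T : List Var) (p p′ : Env A) (q q′ : Env B) : Set where
    field
      into   : ∀ {u} → u ∈ T → renameVar u ∈ S
      pull-p : Pulls A T p′ p
      pull-q : Pulls B T q′ q

  module _ {S T p p′ q q′} (pb : Pullback S T p p′ q q′) where
    open Pullback pb

    pull-agree : ∀ {u v} (f : Fin (size A) → Fin (size A) → Bool)
                 (g : Fin (size B) → Fin (size B) → Bool) → u ∈ T → v ∈ T →
                 lift2 f (p (renameVar u)) (p (renameVar v)) ≡ lift2 g (q (renameVar u)) (q (renameVar v)) →
                 lift2 f (p′ u) (p′ v) ≡ lift2 g (q′ u) (q′ v)
    pull-agree f g u∈T v∈T e =
      trans (cong₂ (lift2 f) (pull-p u∈T) (pull-p v∈T))
        (trans e (sym (cong₂ (lift2 g) (pull-q u∈T) (pull-q v∈T))))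

    ordAgree-pullback : ∀ {u v} → u ∈ T → v ∈ T →
                        OrdAgree A B p q (renameVar u) (renameVar v) → OrdAgree A B p′ q′ u v
    ordAgree-pullback u∈T v∈T (e= , e<) =
      pull-agree eqF eqF u∈T v∈T e= , pull-agree (lt A) (lt B) u∈T v∈T e<

    inCluster-pullback : ∀ {w α u} → (w ∷ʳ α , 0) ∈ T → InCluster T w α u →
                         InCluster S (rename w) (renameLast w α) (renameVar u) × u ∈ T
    inCluster-pullback _ (inj₁ (i , refl , u∈T)) = inj₁ (i , refl , into u∈T) , u∈T
    inCluster-pullback {w} {α} c∈T (inj₂ refl) = inj₂ (cong (_, 0) (rename-∷ʳ w α)) , c∈T

    winning-pullback : Winning A B S p q → Winning A B T p′ q′
    winning-pullback (clusters , children) = clusters′ , children′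
      where
      clusters′ : ClustersAgree A B T p′ q′
      clusters′ w w∈T = predicates , pairs
        where
        predicates = λ i wi∈T ℓ →
          trans (cong (lift1 (P A ℓ)) (pull-p wi∈T))
            (trans (proj₁ (clusters _ (into w∈T)) i (into wi∈T) ℓ) (sym (cong (lift1 (P B ℓ)) (pull-q wi∈T))))
        pairs = λ i j wi∈T wj∈T →
          let ord , edge = proj₂ (clusters _ (into w∈T)) i j (into wi∈T) (into wj∈T)
          in ordAgree-pullback wi∈T wj∈T ord , pull-agree (E A) (E B) wi∈T wj∈T edge
      children′ : ChildrenAgree A B T p′ q′
      children′ w α c∈T u v u∈ v∈ =
        let u∈′ , u∈T = inCluster-pullback c∈T u∈
            v∈′ , v∈T = inCluster-pullback c∈T v∈
            c∈S = subst (_∈ S) (cong (_, 0) (rename-∷ʳ w α)) (into c∈T)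
        in ordAgree-pullback u∈T v∈T (children _ _ c∈S _ _ u∈′ v∈′)

  Onto : List Var → List Var → Set
  Onto S T = ∀ {u} → u ∈ S → renameVar u ∈ T

  move-rename : ∀ {S T v m} → (∀ {u} → u ∈ T → renameVar u ∈ S) → Onto S T →
                Move T v m → Move S (renameVar v) (Maybe.map renameVar m)
  move-rename {[]} _ _ (mRoot refl) =
    subst (λ x → Move [] (x , 0) nothing) (sym rename-[]) (mRoot refl)
  move-rename {_ ∷ _} _ onto (mRoot refl) with () ← onto (here refl)
  move-rename {S} {T} into onto (mChild w α w∈T child∉T) =
    subst (λ x → Move S (x , 0) nothing) (sym (rename-∷ʳ w α))
      (mChild (rename w) (renameLast w α) (into w∈T)
         (λ c∈S → child∉T (subst (_∈ T) back (onto c∈S))))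
    where
    back : renameVar (rename w ∷ʳ renameLast w α , 0) ≡ (w ∷ʳ α , 0)
    back = cong (_, 0) (trans (cong rename (sym (rename-∷ʳ w α))) (rename-involutive (w ∷ʳ α)))
  move-rename {S} {T} into onto (mNbr w i j w∈T wi∉T below j<i) =
    mNbr (rename w) i j (into w∈T)
      (λ wi∈S → wi∉T (subst (_∈ T) (renameVar-involutive (w , i)) (onto wi∈S)))
      (λ i′ i′<i → into (below i′ i′<i)) j<i

  module _ {G : OrderedGraph N} {T : List Var} {ρ ρ′ : Env G} (pull : Pulls G T ρ′ ρ) where

    anchored-pull : ∀ {v m} a → Move T v m →
                    Anchored G ρ′ m a ⇔ Anchored G ρ (Maybe.map renameVar m) a
    anchored-pull {m = nothing} a _  = mk⇔ id id
    anchored-pull {m = just u}  a mv = mk⇔ (subst adjacent (pull (anchor-∈ mv)))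
                                           (subst adjacent (sym (pull (anchor-∈ mv))))
      where adjacent = λ x → lift2 (E G) (just a) x ≡ true

    pulls-update : ∀ v a → Pulls G (v ∷ T) (update G ρ′ v a) (update G ρ (renameVar v) a)
    pulls-update v a {u} u∈ with u ≟V v
    ... | yes refl = sym (update-≡ G ρ (renameVar v) a)
    pulls-update v a (here refl)  | no u≢v = ⊥-elim (u≢v refl)
    pulls-update v a (there u∈T) | no u≢v =
      trans (pull u∈T) (sym (update-≢ G ρ (renameVar v) a (u≢v ∘ renameVar-injective)))

  pullback-update : ∀ {S T p p′ q q′} → Pullback S T p p′ q q′ → ∀ v a b →
                    Pullback (renameVar v ∷ S) (v ∷ T) (update A p (renameVar v) a) (update A p′ v a)
                                                         (update B q (renameVar v) b) (update B q′ v b)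
  pullback-update pb v a b = record
    { into   = λ { (here refl) → here refl ; (there u∈T) → there (into u∈T) }
    ; pull-p = pulls-update pull-p v a
    ; pull-q = pulls-update pull-q v b
    }
    where open Pullback pb

  onto-update : ∀ {S T} v → Onto S T → Onto (renameVar v ∷ S) (v ∷ T)
  onto-update v onto (here refl)  = here (renameVar-involutive v)
  onto-update v onto (there u∈S) = there (onto u∈S)

  dupWins-rename : ∀ k {S T p p′ q q′} → Pullback S T p p′ q q′ → Onto S T →
                   DupWinsFrom A B k S p q → DupWinsFrom A B k T p′ q′
  dupWins-rename zero    pb _    W              = winning-pullback pb W
  dupWins-rename (suc k) {S} {T} {p} {p′} {q} {q′} pb onto (forth , back) = forth′ , back′
    where
    open Pullback pb
    forth′ : ∀ v m → Move T v m → ForthAnswers A B k T p′ q′ v m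
    forth′ v m mv a an =
      let b , bn , D = forth _ _ (move-rename into onto mv) a (to (anchored-pull pull-p a mv) an)
      in b , from (anchored-pull pull-q b mv) bn ,
         dupWins-rename k (pullback-update pb v a b) (onto-update v onto) D
    back′ : ∀ v m → Move T v m → BackAnswers A B k T p′ q′ v m
    back′ v m mv b bn =
      let a , an , D = back _ _ (move-rename into onto mv) b (to (anchored-pull pull-q b mv) bn)
      in a , from (anchored-pull pull-p a mv) an ,
         dupWins-rename k (pullback-update pb v a b) (onto-update v onto) D

transpose : ℕ → ℕ → ℕ → ℕ
transpose a b x with x ≟ a | x ≟ b
... | yes _ | _     = b
... | no _  | yes _ = a
... | no _  | no _  = x

transpose-a : ∀ a b → transpose a b a ≡ b
transpose-a a b with a ≟ a
... | yes _  = refl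
... | no a≢a = ⊥-elim (a≢a refl)

transpose-b : ∀ a b → transpose a b b ≡ a
transpose-b a b with b ≟ a | b ≟ b
... | yes b≡a | _      = b≡a
... | no _    | yes _  = refl
... | no _    | no b≢b = ⊥-elim (b≢b refl)

transpose-other : ∀ a b x → x ≢ a → x ≢ b → transpose a b x ≡ x
transpose-other a b x x≢a x≢b with x ≟ a | x ≟ b
... | yes x≡a | _       = ⊥-elim (x≢a x≡a)
... | no _    | yes x≡b = ⊥-elim (x≢b x≡b)
... | no _    | no _    = refl

transpose-involutive : ∀ a b x → transpose a b (transpose a b x) ≡ x
transpose-involutive a b x with x ≟ a | x ≟ b
... | yes refl | _        = transpose-b x b
... | no _     | yes refl = transpose-a a x
... | no x≢a   | no x≢b   = transpose-other a b x x≢a x≢b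

-- swapBelow w a b exchanges the letters a and b at position length w, in words extending w.
swapBelow : Word → ℕ → ℕ → Word → Word
swapBelow []      a b []      = []
swapBelow []      a b (x ∷ r) = transpose a b x ∷ r
swapBelow (c ∷ w) a b []      = []
swapBelow (c ∷ w) a b (x ∷ r) with x ≟ c
... | yes _ = x ∷ swapBelow w a b r
... | no _  = x ∷ r

swapBelowLast : Word → ℕ → ℕ → Word → ℕ → ℕ
swapBelowLast []      a b []      x = transpose a b x
swapBelowLast []      a b (_ ∷ _) x = x
swapBelowLast (c ∷ w) a b []      x = x
swapBelowLast (c ∷ w) a b (y ∷ r) x with y ≟ c
... | yes _ = swapBelowLast w a b r x
... | no _  = x

swapBelow-∷ : ∀ c w a b r → swapBelow (c ∷ w) a b (c ∷ r) ≡ c ∷ swapBelow w a b r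
swapBelow-∷ c w a b r with c ≟ c
... | yes _  = refl
... | no c≢c = ⊥-elim (c≢c refl)

swapBelow-≢ : ∀ c w a b x r → x ≢ c → swapBelow (c ∷ w) a b (x ∷ r) ≡ x ∷ r
swapBelow-≢ c w a b x r x≢c with x ≟ c
... | yes x≡c = ⊥-elim (x≢c x≡c)
... | no _    = refl

swapBelow-involutive : ∀ w a b u → swapBelow w a b (swapBelow w a b u) ≡ u
swapBelow-involutive []      a b []      = refl
swapBelow-involutive []      a b (x ∷ r) = cong (_∷ r) (transpose-involutive a b x)
swapBelow-involutive (c ∷ w) a b []      = refl
swapBelow-involutive (c ∷ w) a b (x ∷ r) with x ≟ c
... | yes refl = trans (swapBelow-∷ x w a b _) (cong (x ∷_) (swapBelow-involutive w a b r))
... | no x≢c   = swapBelow-≢ c w a b x r x≢c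

swapBelow-[] : ∀ w a b → swapBelow w a b [] ≡ []
swapBelow-[] []      a b = refl
swapBelow-[] (_ ∷ _) a b = refl

swapBelow-∷ʳ : ∀ w a b u x →
               swapBelow w a b (u ∷ʳ x) ≡ swapBelow w a b u ∷ʳ swapBelowLast w a b u x
swapBelow-∷ʳ []      a b []      x = refl
swapBelow-∷ʳ []      a b (y ∷ u) x = refl
swapBelow-∷ʳ (c ∷ w) a b []      x with x ≟ c
... | yes _ = cong (x ∷_) (swapBelow-[] w a b)
... | no _  = refl
swapBelow-∷ʳ (c ∷ w) a b (y ∷ u) x with y ≟ c
... | yes _ = cong (y ∷_) (swapBelow-∷ʳ w a b u x)
... | no _  = refl

swapBelow-a : ∀ w a b → swapBelow w a b (w ∷ʳ a) ≡ w ∷ʳ b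
swapBelow-a []      a b = cong [_] (transpose-a a b)
swapBelow-a (c ∷ w) a b = trans (swapBelow-∷ c w a b _) (cong (c ∷_) (swapBelow-a w a b))

swapBelow-b : ∀ w a b → swapBelow w a b (w ∷ʳ b) ≡ w ∷ʳ a
swapBelow-b []      a b = cong [_] (transpose-b a b)
swapBelow-b (c ∷ w) a b = trans (swapBelow-∷ c w a b _) (cong (c ∷_) (swapBelow-b w a b))

swapBelow-fixed : ∀ w a b u → (∀ r → u ≢ w ++ a ∷ r) → (∀ r → u ≢ w ++ b ∷ r) →
                  swapBelow w a b u ≡ u
swapBelow-fixed []      a b []      _ _ = refl
swapBelow-fixed []      a b (x ∷ r) u≢a u≢b =
  cong (_∷ r) (transpose-other a b x (λ x≡a → u≢a r (cong (_∷ r) x≡a))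
                                     (λ x≡b → u≢b r (cong (_∷ r) x≡b)))
swapBelow-fixed (c ∷ w) a b []      _ _ = refl
swapBelow-fixed (c ∷ w) a b (x ∷ r) u≢a u≢b with x ≟ c
... | yes refl = cong (x ∷_) (swapBelow-fixed w a b r (λ r′ e → u≢a r′ (cong (x ∷_) e))
                                                    (λ r′ e → u≢b r′ (cong (x ∷_) e)))
... | no _     = refl

swapRenaming : Word → ℕ → ℕ → WordRenaming
swapRenaming w a b = record
  { rename            = swapBelow w a b
  ; renameLast        = swapBelowLast w a b
  ; rename-involutive = swapBelow-involutive w a b
  ; rename-[]         = swapBelow-[] w a b
  ; rename-∷ʳ         = swapBelow-∷ʳ w a b
  }

module _ {N} (A B : OrderedGraph N) where

  dupWins-renameChild :
    ∀ k {S} w α₀ α {p q a b} → Valid S → (w ∷ʳ α₀ , 0) ∉ S → (w ∷ʳ α , 0) ∉ S →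
    DupWinsFrom A B k ((w ∷ʳ α₀ , 0) ∷ S) (update A p (w ∷ʳ α₀ , 0) a) (update B q (w ∷ʳ α₀ , 0) b) →
    DupWinsFrom A B k ((w ∷ʳ α  , 0) ∷ S) (update A p (w ∷ʳ α  , 0) a) (update B q (w ∷ʳ α  , 0) b)
  dupWins-renameChild k {S} w α₀ α {p} {q} {a} {b} V c₀∉S c∉S =
    dupWins-rename k (record { into = into ; pull-p = pull A p a ; pull-q = pull B q b }) onto
    where
    open WordRenaming (swapRenaming w α₀ α)
    open Renaming A B (swapRenaming w α₀ α)
    c₀ c : Var
    c₀ = w ∷ʳ α₀ , 0
    c  = w ∷ʳ α , 0

    ≢child : ∀ {u β} → (w ∷ʳ β , 0) ∉ S → u ∈ S → u ≢ (w ∷ʳ β , 0)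
    ≢child child∉S u∈S refl = child∉S u∈S

    -- No word of S extends either child: S is prefix closed and contains neither.
    fixes : ∀ {u} → u ∈ S → renameVar u ≡ u
    fixes {x , i} u∈S = cong (_, i) (swapBelow-fixed w α₀ α x (outside c₀∉S) (outside c∉S))
      where
      outside : ∀ {β} → (w ∷ʳ β , 0) ∉ S → ∀ r → x ≢ w ++ β ∷ r
      outside {β} child∉S r refl = child∉S
        (prefix-∈ V (w ∷ʳ β) r (subst (λ y → (y , 0) ∈ S) (sym (List.∷ʳ-++ w β r)) (cluster-∈ V u∈S)))

    c↦c₀ : renameVar c ≡ c₀
    c↦c₀ = cong (_, 0) (swapBelow-b w α₀ α)

    c₀↦c : renameVar c₀ ≡ c
    c₀↦c = cong (_, 0) (swapBelow-a w α₀ α)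

    into : ∀ {u} → u ∈ c ∷ S → renameVar u ∈ c₀ ∷ S
    into (here refl)  = here c↦c₀
    into (there u∈S) = there (subst (_∈ S) (sym (fixes u∈S)) u∈S)

    onto : Onto (c₀ ∷ S) (c ∷ S)
    onto (here refl)  = here c₀↦c
    onto (there u∈S) = there (subst (_∈ S) (sym (fixes u∈S)) u∈S)

    pull : ∀ (G : OrderedGraph N) ρ x → Pulls G (c ∷ S) (update G ρ c x) (update G ρ c₀ x)
    pull G ρ x (here refl) =
      trans (update-≡ G ρ c x) (sym (trans (cong (update G ρ c₀ x) c↦c₀) (update-≡ G ρ c₀ x)))
    pull G ρ x (there u∈S) =
      trans (update-≢ G ρ c x (≢child c∉S u∈S))
        (sym (trans (cong (update G ρ c₀ x) (fixes u∈S)) (update-≢ G ρ c₀ x (≢child c₀∉S u∈S))))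

  answers-renameChild :
    ∀ {k S w α₀ α p q} → Valid S → (w ∷ʳ α₀ , 0) ∉ S → (w ∷ʳ α , 0) ∉ S →
    ForthAnswers A B k S p q (w ∷ʳ α₀ , 0) nothing × BackAnswers A B k S p q (w ∷ʳ α₀ , 0) nothing →
    ForthAnswers A B k S p q (w ∷ʳ α  , 0) nothing × BackAnswers A B k S p q (w ∷ʳ α  , 0) nothing
  answers-renameChild {k} {w = w} {α₀} {α} V c₀∉S c∉S (forth , back) =
    (λ a _ → let b , _ , D = forth a tt in b , tt , dupWins-renameChild k w α₀ α V c₀∉S c∉S D) ,
    (λ b _ → let a , _ , D = back b tt in a , tt , dupWins-renameChild k w α₀ α V c₀∉S c∉S D)

lift2-flip : ∀ {X : Set} (f : X → X → Bool) x y → lift2 (flip f) x y ≡ lift2 f y x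
lift2-flip f (just a) (just b) = refl
lift2-flip f (just a) nothing  = refl
lift2-flip f nothing  (just b) = refl
lift2-flip f nothing  nothing  = refl

eqF-comm : ∀ {n} (a b : Fin n) → eqF a b ≡ eqF b a
eqF-comm a b with a Fin.≟ b | b Fin.≟ a
... | yes _   | yes _   = refl
... | no _    | no _    = refl
... | yes a≡b | no b≢a  = ⊥-elim (b≢a (sym a≡b))
... | no a≢b  | yes b≡a = ⊥-elim (a≢b (sym b≡a))

lift2-eqF-comm : ∀ {n} (x y : Maybe (Fin n)) → lift2 eqF x y ≡ lift2 eqF y x
lift2-eqF-comm (just a) (just b) = eqF-comm a b
lift2-eqF-comm (just a) nothing  = refl
lift2-eqF-comm nothing  (just b) = refl
lift2-eqF-comm nothing  nothing  = refl

module _ {N} (A B : OrderedGraph N) {S : List Var} {p : Env A} {q : Env B} where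

  AtomsAgree : Set
  AtomsAgree = ∀ {φ} → Atom S φ → sat A p φ ≡ sat B q φ

  private
    reverse : ∀ {u v} f g → lift2 f (p u) (p v) ≡ lift2 g (q u) (q v) →
              lift2 (flip f) (p v) (p u) ≡ lift2 (flip g) (q v) (q u)
    reverse {u} {v} f g e = trans (lift2-flip f (p v) (p u)) (trans e (sym (lift2-flip g (q v) (q u))))

    reverse-eq : ∀ {u v} → lift2 eqF (p u) (p v) ≡ lift2 eqF (q u) (q v) →
                 lift2 eqF (p v) (p u) ≡ lift2 eqF (q v) (q u)
    reverse-eq {u} {v} e = trans (lift2-eqF-comm (p v) (p u)) (trans e (lift2-eqF-comm (q u) (q v)))

  atoms-agree : Valid S → Winning A B S p q → AtomsAgree
  atoms-agree V (clusters , children) = agree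
    where
    pair : ∀ {w i j} → (w , i) ∈ S → (w , j) ∈ S → FullAgree A B p q (w , i) (w , j)
    pair {w} {i} {j} wi∈S wj∈S = proj₂ (clusters w (cluster-∈ V wi∈S)) i j wi∈S wj∈S
    child : ∀ {w α i} → (w ∷ʳ α , 0) ∈ S → (w , i) ∈ S → OrdAgree A B p q (w ∷ʳ α , 0) (w , i)
    child {w} {α} {i} c∈S wi∈S = children w α c∈S _ _ (inj₂ refl) (inj₁ (i , refl , wi∈S))
    agree : AtomsAgree
    agree (aP ℓ (w , i) wi∈S)          = proj₁ (clusters w (cluster-∈ V wi∈S)) i wi∈S ℓ
    agree (aE w i j wi∈S wj∈S)         = proj₂ (pair wi∈S wj∈S)
    agree (aCmp ceq w i j wi∈S wj∈S)   = proj₁ (proj₁ (pair wi∈S wj∈S))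
    agree (aCmp clt w i j wi∈S wj∈S)   = proj₂ (proj₁ (pair wi∈S wj∈S))
    agree (aCmp cgt w i j wi∈S wj∈S)   = reverse (lt A) (lt B) (proj₂ (proj₁ (pair wj∈S wi∈S)))
    agree (aChild ceq w α i c∈S wi∈S) = proj₁ (child c∈S wi∈S)
    agree (aChild clt w α i c∈S wi∈S) = proj₂ (child c∈S wi∈S)
    agree (aChild cgt w α i c∈S wi∈S) =
      reverse (lt A) (lt B) (proj₂ (children w α c∈S _ _ (inj₁ (i , refl , wi∈S)) (inj₂ refl)))

  winning-from-atoms : AtomsAgree → Winning A B S p q
  winning-from-atoms agree = clusters , children
    where
    pair : ∀ w i j → (w , i) ∈ S → (w , j) ∈ S → FullAgree A B p q (w , i) (w , j)
    pair w i j wi∈S wj∈S =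
      (agree (aCmp ceq w i j wi∈S wj∈S) , agree (aCmp clt w i j wi∈S wj∈S)) , agree (aE w i j wi∈S wj∈S)
    clusters : ClustersAgree A B S p q
    clusters w _ = (λ i wi∈S ℓ → agree (aP ℓ (w , i) wi∈S)) , pair w
    children : ChildrenAgree A B S p q
    children w α c∈S _ _ (inj₁ (i , refl , wi∈S)) (inj₁ (j , refl , wj∈S)) =
      proj₁ (pair w i j wi∈S wj∈S)
    children w α c∈S _ _ (inj₂ refl) (inj₂ refl) = proj₁ (pair (w ∷ʳ α) 0 0 c∈S c∈S)
    children w α c∈S _ _ (inj₂ refl) (inj₁ (j , refl , wj∈S)) =
      agree (aChild ceq w α j c∈S wj∈S) , agree (aChild clt w α j c∈S wj∈S)
    children w α c∈S _ _ (inj₁ (i , refl , wi∈S)) (inj₂ refl) =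
      reverse-eq (agree (aChild ceq w α i c∈S wi∈S)) ,
      reverse (flip (lt A)) (flip (lt B)) (agree (aChild cgt w α i c∈S wi∈S))

-- Strategies preserve CFO formulas

module _ {N} (A B : OrderedGraph N) where

  Assigned : List Var → Env A → Set
  Assigned S p = ∀ {u} → u ∈ S → ∃[ a ] p u ≡ just a

  assigned-update : ∀ {S p} → Assigned S p → ∀ v a → Assigned (v ∷ S) (update A p v a)
  assigned-update {S} {p} as v a {u} u∈ with u ≟V v
  ... | yes _ = a , refl
  assigned-update as v a (here refl)  | no u≢v = ⊥-elim (u≢v refl)
  assigned-update as v a (there u∈S) | no _   = as u∈S

  winning-restrict : ∀ {S v m p q a b} → Move S v m →
                     Winning A B (v ∷ S) (update A p v a) (update B q v b) → Winning A B S p q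
  winning-restrict {S} {v} {p = p} {q} {a} {b} mv = winning-pullback record
    { into   = there
    ; pull-p = λ u∈S → sym (update-≢ A p v a (≢v u∈S))
    ; pull-q = λ u∈S → sym (update-≢ B q v b (≢v u∈S))
    }
    where
    open Renaming A B identityRenaming
    ≢v : ∀ {u} → u ∈ S → u ≢ v
    ≢v u∈S refl = move-∉ mv u∈S

  -- Spoiler may spend the rounds on dummy moves (fresh children of an existing pebble); the
  -- resulting winning configuration restricts to S.
  dupWins⇒winning : ∀ k {S p q} → Valid S → Assigned S p → DupWinsFrom A B k S p q →
                    Winning A B S p q
  dupWins⇒winning zero    _ _ W = W
  dupWins⇒winning (suc k) {[]} _ _ _ = (λ _ ()) , (λ _ _ ())
  dupWins⇒winning (suc k) {(w , i) ∷ S} V as (forth , _) =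
    let a , _     = as (here refl)
        b , _ , D = forth _ _ mv a tt
    in winning-restrict mv (dupWins⇒winning k (valid-move V mv) (assigned-update as _ a) D)
    where
    mv = mChild w (freshLetter ((w , i) ∷ S)) (cluster-∈ V (here refl)) (freshLetter-fresh _ w)

  answers⇒ex-agree : ∀ {k S p q v m} ψ → AnchorDistinct v m →
             ForthAnswers A B k S p q v m → BackAnswers A B k S p q v m →
             (∀ {a b} → DupWinsFrom A B k (v ∷ S) (update A p v a) (update B q v b) →
                        sat A (update A p v a) ψ ≡ sat B (update B q v b) ψ) →
             sat A p (fEx v (guarded m v ψ)) ≡ sat B q (fEx v (guarded m v ψ))
  answers⇒ex-agree {p = p} {q} {v} {m} ψ v≠m forth back agree = ⇔→≡ (mk⇔ forth′ back′)
    where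
    forth′ : Sat A p (fEx v (guarded m v ψ)) → Sat B q (fEx v (guarded m v ψ))
    forth′ s =
      let a , g      = to (sat-ex A p v (guarded m v ψ)) s
          an , sψ    = to (sat-guarded A p a ψ v≠m) g
          b , bn , D = forth a an
      in from (sat-ex B q v (guarded m v ψ))
           (b , from (sat-guarded B q b ψ v≠m) (bn , trans (sym (agree D)) sψ))
    back′ : Sat B q (fEx v (guarded m v ψ)) → Sat A p (fEx v (guarded m v ψ))
    back′ s =
      let b , g      = to (sat-ex B q v (guarded m v ψ)) s
          bn , sψ    = to (sat-guarded B q b ψ v≠m) g
          a , an , D = back b bn
      in from (sat-ex A p v (guarded m v ψ))
           (a , from (sat-guarded A p a ψ v≠m) (an , trans (agree D) sψ))

  move-agree : ∀ {k S v m ψ} → Move S v m → CFO (v ∷ S) k ψ → ∀ {p q} → Valid S → Assigned S p →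
               DupWinsFrom A B (suc k) S p q →
               sat A p (fEx v (guarded m v ψ)) ≡ sat B q (fEx v (guarded m v ψ))

  cfo-agree : ∀ {k S φ} → CFO S k φ → ∀ {p q} → Valid S → Assigned S p → DupWinsFrom A B k S p q →
              sat A p φ ≡ sat B q φ
  cfo-agree (atom at) V as D = atoms-agree A B V (dupWins⇒winning _ V as D) at
  cfo-agree true       _ _  _ = refl
  cfo-agree (neg c)    V as D = cong not (cfo-agree c V as D)
  cfo-agree (conj c d) V as D = cong₂ _∧_ (cfo-agree c V as D) (cfo-agree d V as D)
  cfo-agree (exRoot refl c) V as D = move-agree (mRoot refl) c V as D
  cfo-agree (exChild w α w∈S c∉S c) V as D = move-agree (mChild w α w∈S c∉S) c V as D
  cfo-agree (exNbr w i j wj∈S wi∉S below c) V as D =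
    move-agree (mNbr w i j (cluster-∈ V wj∈S) wi∉S below (∈∉⇒< V wj∈S wi∉S)) c V as D

  move-agree mv c V as (forth , back) =
    answers⇒ex-agree _ (move-anchorDistinct mv) (forth _ _ mv) (back _ _ mv)
      (λ {a} D → cfo-agree c (valid-move V mv) (assigned-update as _ a) D)

  dupWins⇒sameCFO : ∀ k → DupWins k A B → SameCFO k A B
  dupWins⇒sameCFO k D φ c = cfo-agree c valid-[] (λ ()) D

-- Hintikka formulas

initLast-∷ʳ : ∀ {X : Set} (w : List X) x → initLast (w ∷ʳ x) ≡ w ∷ʳ′ x
initLast-∷ʳ []      x = refl
initLast-∷ʳ (y ∷ w) x rewrite initLast-∷ʳ w x = refl

comparisons : List Cmp
comparisons = ceq ∷ clt ∷ cgt ∷ []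

∈-comparisons : ∀ r → r ∈ comparisons
∈-comparisons ceq = here refl
∈-comparisons clt = there (here refl)
∈-comparisons cgt = there (there (here refl))

module _ {N : ℕ} where

  predicateAtoms : Var → List (Formula N)
  predicateAtoms v = map (λ ℓ → fP ℓ v) (allFin N)

  clusterAtoms : Var → Var → List (Formula N)
  clusterAtoms (x , i) (y , j) with x ≟W y
  ... | yes refl = fE (x , i) (x , j) ∷ map (λ r → fCmp r (x , i) (x , j)) comparisons
  ... | no _     = []

  childAtoms : Var → Var → List (Formula N)
  childAtoms (x , suc _) _ = []
  childAtoms (x , zero) (y , j) with initLast x
  ... | []      = []
  ... | z ∷ʳ′ α with z ≟W y
  ...   | yes refl = map (λ r → fCmp r (z ∷ʳ α , 0) (z , j)) comparisons
  ...   | no _     = []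

  pairAtoms : Var → Var → List (Formula N)
  pairAtoms u v = clusterAtoms u v ++ childAtoms u v

  atomsOf : List Var → List (Formula N)
  atomsOf S = concatMap predicateAtoms S ++ concatMap (λ u → concatMap (pairAtoms u) S) S

  module _ {S : List Var} where

    predicateAtoms-atom : ∀ {v φ} → v ∈ S → φ ∈ predicateAtoms v → Atom S φ
    predicateAtoms-atom {v} v∈S φ∈ with ℓ , _ , refl ← ∈-map⁻ (λ ℓ → fP ℓ v) φ∈ = aP ℓ v v∈S

    clusterAtoms-atom : ∀ {u v φ} → u ∈ S → v ∈ S → φ ∈ clusterAtoms u v → Atom S φ
    clusterAtoms-atom {x , i} {y , j} u∈S v∈S φ∈ with x ≟W y
    clusterAtoms-atom u∈S v∈S (here refl) | yes refl = aE _ _ _ u∈S v∈S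
    clusterAtoms-atom {x , i} {_ , j} u∈S v∈S (there φ∈) | yes refl
      with r , _ , refl ← ∈-map⁻ (λ r → fCmp r (x , i) (x , j)) φ∈ = aCmp r x i j u∈S v∈S

    childAtoms-atom : ∀ {u v φ} → u ∈ S → v ∈ S → φ ∈ childAtoms u v → Atom S φ
    childAtoms-atom {x , zero} {y , j} u∈S v∈S φ∈ with initLast x
    ... | z ∷ʳ′ α with z ≟W y
    ...   | yes refl with r , _ , refl ← ∈-map⁻ (λ r → fCmp r (z ∷ʳ α , 0) (z , j)) φ∈ =
      aChild r z α j u∈S v∈S

    atomsOf-atom : ∀ {φ} → φ ∈ atomsOf S → Atom S φ
    atomsOf-atom φ∈ with ∈-++⁻ (concatMap predicateAtoms S) φ∈
    ... | inj₁ φ∈P with v , v∈S , φ∈v ← find (∈-concatMap⁻ predicateAtoms φ∈P) =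
      predicateAtoms-atom v∈S φ∈v
    ... | inj₂ φ∈R with u , u∈S , φ∈u ← find (∈-concatMap⁻ (λ u → concatMap (pairAtoms u) S) φ∈R)
                   with v , v∈S , φ∈uv ← find (∈-concatMap⁻ (pairAtoms u) φ∈u)
                   with ∈-++⁻ (clusterAtoms u v) φ∈uv
    ...   | inj₁ φ∈c = clusterAtoms-atom u∈S v∈S φ∈c
    ...   | inj₂ φ∈c = childAtoms-atom u∈S v∈S φ∈c

    pairAtoms⊆atomsOf : ∀ {u v φ} → u ∈ S → v ∈ S → φ ∈ pairAtoms u v → φ ∈ atomsOf S
    pairAtoms⊆atomsOf {u} u∈S v∈S φ∈ =
      ∈-++⁺ʳ (concatMap predicateAtoms S)
        (∈-concatMap⁺ (λ u → concatMap (pairAtoms u) S)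
           (lose u∈S (∈-concatMap⁺ (pairAtoms u) (lose v∈S φ∈))))

  edge∈clusterAtoms : ∀ w i j → fE (w , i) (w , j) ∈ clusterAtoms (w , i) (w , j)
  edge∈clusterAtoms w i j with w ≟W w
  ... | yes refl = here refl
  ... | no w≢w   = ⊥-elim (w≢w refl)

  cmp∈clusterAtoms : ∀ r w i j → fCmp r (w , i) (w , j) ∈ clusterAtoms (w , i) (w , j)
  cmp∈clusterAtoms r w i j with w ≟W w
  ... | yes refl = there (∈-map⁺ (λ r → fCmp r (w , i) (w , j)) (∈-comparisons r))
  ... | no w≢w   = ⊥-elim (w≢w refl)

  cmp∈childAtoms : ∀ r w α j → fCmp r (w ∷ʳ α , 0) (w , j) ∈ childAtoms (w ∷ʳ α , 0) (w , j)
  cmp∈childAtoms r w α j rewrite initLast-∷ʳ w α with w ≟W w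
  ... | yes refl = ∈-map⁺ (λ r → fCmp r (w ∷ʳ α , 0) (w , j)) (∈-comparisons r)
  ... | no w≢w   = ⊥-elim (w≢w refl)

  atom∈atomsOf : ∀ {S φ} → Atom S φ → φ ∈ atomsOf S
  atom∈atomsOf (aP ℓ v v∈S) =
    ∈-++⁺ˡ (∈-concatMap⁺ predicateAtoms (lose v∈S (∈-map⁺ (λ ℓ → fP ℓ v) (∈-allFin ℓ))))
  atom∈atomsOf (aE w i j wi∈S wj∈S) =
    pairAtoms⊆atomsOf wi∈S wj∈S (∈-++⁺ˡ (edge∈clusterAtoms w i j))
  atom∈atomsOf (aCmp r w i j wi∈S wj∈S) =
    pairAtoms⊆atomsOf wi∈S wj∈S (∈-++⁺ˡ (cmp∈clusterAtoms r w i j))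
  atom∈atomsOf (aChild r w α i c∈S wi∈S) =
    pairAtoms⊆atomsOf c∈S wi∈S (∈-++⁺ʳ (clusterAtoms _ _) (cmp∈childAtoms r w α i))

clusterMoves : List Var → Var → List (Var × Maybe Var)
clusterMoves S (w , suc _) = []
clusterMoves S (w , zero)  =
  ((w ∷ʳ freshLetter S , 0) , nothing) ∷
  map (λ j → (w , nextIndex S w) , just (w , j)) (upTo (nextIndex S w))

-- Up to renaming the new letter of a child move, every move is one of these.
canonicalMoves : List Var → List (Var × Maybe Var)
canonicalMoves []        = [ ([] , 0) , nothing ]
canonicalMoves S@(_ ∷ _) = concatMap (clusterMoves S) S

canonicalMove-legal : ∀ {S v m} → Valid S → (v , m) ∈ canonicalMoves S → Move S v m
canonicalMove-legal {[]} V (here refl) = mRoot refl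
canonicalMove-legal {S@(_ ∷ _)} V vm∈
  with u , u∈S , vm∈u ← find (∈-concatMap⁻ (clusterMoves S) vm∈) = legal u∈S vm∈u
  where
  legal : ∀ {u v m} → u ∈ S → (v , m) ∈ clusterMoves S u → Move S v m
  legal {w , zero} w∈S (here refl) = mChild w (freshLetter S) w∈S (freshLetter-fresh S w)
  legal {w , zero} w∈S (there vm∈)
    with j , j∈ , refl ← ∈-map⁻ (λ j → (w , nextIndex S w) , just (w , j)) vm∈ =
    mNbr w (nextIndex S w) j w∈S (nextIndex-∉ S w) (λ _ → <nextIndex⇒∈ V w) (∈-upTo⁻ j∈)

freshChild∈canonical : ∀ {S w} → (w , 0) ∈ S →
                       ((w ∷ʳ freshLetter S , 0) , nothing) ∈ canonicalMoves S
freshChild∈canonical {S@(_ ∷ _)} w∈S = ∈-concatMap⁺ (clusterMoves S) (lose w∈S (here refl))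

neighbour∈canonical : ∀ {S w j} → (w , 0) ∈ S → j < nextIndex S w →
                      ((w , nextIndex S w) , just (w , j)) ∈ canonicalMoves S
neighbour∈canonical {S@(_ ∷ _)} {w} w∈S j< =
  ∈-concatMap⁺ (clusterMoves S)
    (lose w∈S (there (∈-map⁺ (λ j → (w , nextIndex S w) , just (w , j)) (∈-upTo⁺ j<))))

module Hintikka {N} (A : OrderedGraph N) where

  literal : Env A → Formula N → Formula N
  literal p φ = if sat A p φ then φ else fNot φ

  literal-holds : ∀ p φ → Sat A p (literal p φ)
  literal-holds p φ with sat A p φ in e
  ... | true  = e
  ... | false rewrite e = refl

  literal-agree : ∀ {G : OrderedGraph N} p ρ φ → Sat G ρ (literal p φ) → sat A p φ ≡ sat G ρ φ
  literal-agree {G} p ρ φ s with sat A p φ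
  ... | true  = sym s
  ... | false = sym (trans (sym (not-involutive (sat G ρ φ))) (cong not s))

  literal-cfo : ∀ {S k} p {φ} → CFO S k φ → CFO S k (literal p φ)
  literal-cfo p {φ} c with sat A p φ
  ... | true  = c
  ... | false = neg c

  hintikka : ℕ → List Var → Env A → Formula N
  hintikka zero    S p = bigAnd (literal p) (atomsOf S)
  hintikka (suc k) S p =
    bigAnd (λ (v , m) → moveFormula A p v m (λ a → hintikka k (v ∷ S) (update A p v a)))
           (canonicalMoves S)

  hintikka-holds : ∀ k {S} p → Valid S → Sat A p (hintikka k S p)
  hintikka-holds zero    {S} p V =
    from (sat-bigAnd A p (literal p) (atomsOf S)) (λ {φ} _ → literal-holds p φ)
  hintikka-holds (suc k) {S} p V = from (sat-bigAnd A p _ (canonicalMoves S)) λ {(v , m)} vm∈ →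
    let mv = canonicalMove-legal V vm∈
        holds : ∀ a → Sat A (update A p v a) (hintikka k (v ∷ S) (update A p v a))
        holds a = hintikka-holds k (update A p v a) (valid-move V mv)
    in from (sat-moveFormula A p v m _ A p (move-anchorDistinct mv))
            ((λ a an → a , an , holds a) , (λ b bn → b , bn , holds b))

  hintikka-cfo : ∀ k {S} p → Valid S → CFO S k (hintikka k S p)
  hintikka-cfo zero    {S} p V =
    bigAnd-cfo (literal p) (atomsOf S) (λ φ∈ → literal-cfo p (atom (atomsOf-atom φ∈)))
  hintikka-cfo (suc k) {S} p V = bigAnd-cfo _ (canonicalMoves S) λ {(v , m)} vm∈ →
    let mv = canonicalMove-legal V vm∈ in
    moveFormula-cfo A p v m _ mv (λ a → hintikka-cfo k (update A p v a) (valid-move V mv))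

  module _ (B : OrderedGraph N) where

    hintikka-sound : ∀ k {S} p q → Valid S → Sat B q (hintikka k S p) → DupWinsFrom A B k S p q
    hintikka-sound zero {S} p q V s = winning-from-atoms A B λ {φ} at →
      literal-agree p q φ (to (sat-bigAnd B q (literal p) (atomsOf S)) s (atom∈atomsOf at))
    hintikka-sound (suc k) {S} p q V s =
      (λ _ _ mv → proj₁ (answers mv)) , (λ _ _ mv → proj₂ (answers mv))
      where
      Answers : Var → Maybe Var → Set
      Answers v m = ForthAnswers A B k S p q v m × BackAnswers A B k S p q v m

      canonical : ∀ {v m} → (v , m) ∈ canonicalMoves S → Answers v m
      canonical {v} {m} vm∈ =
        let mv = canonicalMove-legal V vm∈
            forth , back = to (sat-moveFormula A p v m _ B q (move-anchorDistinct mv))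
                              (to (sat-bigAnd B q _ (canonicalMoves S)) s vm∈)
            next : ∀ {a b} → Sat B (update B q v b) (hintikka k (v ∷ S) (update A p v a)) →
                   DupWinsFrom A B k (v ∷ S) (update A p v a) (update B q v b)
            next = hintikka-sound k _ _ (valid-move V mv)
        in (λ a an → let b , bn , sb = forth a an in b , bn , next sb) ,
           (λ b bn → let a , an , sa = back b bn in a , an , next sa)

      answers : ∀ {v m} → Move S v m → Answers v m
      answers (mRoot refl) = canonical (here refl)
      answers (mChild w α w∈S c∉S) =
        answers-renameChild A B V (freshLetter-fresh S w) c∉S (canonical (freshChild∈canonical w∈S))
      answers (mNbr w i j w∈S wi∉S below j<i) with refl ← nextIndex-unique V wi∉S below =
        canonical (neighbour∈canonical w∈S j<i)

module _ {N} (A B : OrderedGraph N) where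
  open Hintikka A

  sameCFO⇒dupWins : ∀ k → SameCFO k A B → DupWins k A B
  sameCFO⇒dupWins k same = hintikka-sound B k _ _ valid-[]
    (trans (sym (same _ (hintikka-cfo k _ valid-[]))) (hintikka-holds k _ valid-[]))

mainTheorem4 : ∀ {N : ℕ} (A B : OrderedGraph N) (k : ℕ) →
               SameCFO k A B ⇔ DupWins k A B
mainTheorem4 A B k = mk⇔ (sameCFO⇒dupWins A B k) (dupWins⇒sameCFO A B k)
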